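{- Let $U:\mathcal{E}\to\mathcal{B}$ be a comprehension category with unit (CCU) and let $U':\mathcal{E}'\to\mathcal{B}$ be a fibration. Then the pullback $U'^*U:U'^*\mathcal{E}\to\mathcal{E}'$ of $U$ along $U'$ is a CCU.
   Context: A CCU is a fibration $U:\mathcal{E}\to\mathcal{B}$ that has fibred terminal objects (each fibre $\mathcal{E}_X$ has a terminal object and reindexing preserves them), such that the truth functor $K:\mathcal{B}\to\mathcal{E}$, sending $X$ to the terminal object of $\mathcal{E}_X$, has a right adjoint. The pullback $U'^*\mathcal{E}$ has objects pairs $(P',P)$ with $P'$ in $\mathcal{E}'$, $P$ in $\mathcal{E}$ and $U'P'=UP$, morphisms pairs of morphisms with equal images in $\mathcal{B}$, and $U'^*U(P',P)=P'$. -}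

module Defs where

open import Level using (Level; _⊔_; suc)
open import Data.Product using (Σ; Σ-syntax; _×_; _,_; proj₁; proj₂)
open import Relation.Binary using (IsEquivalence)
open import Relation.Binary.PropositionalEquality using (_≡_; refl)

record Category (o ℓ e : Level) : Set (suc (o ⊔ ℓ ⊔ e)) where
  infixr 9 _∘_
  infix 4 _≈_
  field
    Obj   : Set o
    _⇒_   : Obj → Obj → Set ℓ
    _≈_   : ∀ {A B} → A ⇒ B → A ⇒ B → Set e
    id    : ∀ {A} → A ⇒ A
    _∘_   : ∀ {A B C} → B ⇒ C → A ⇒ B → A ⇒ C
    equiv : ∀ {A B} → IsEquivalence (_≈_ {A} {B})
    assoc : ∀ {A B C D} {f : A ⇒ B} {g : B ⇒ C} {h : C ⇒ D} →
            (h ∘ g) ∘ f ≈ h ∘ (g ∘ f)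
    identityˡ : ∀ {A B} {f : A ⇒ B} → id ∘ f ≈ f
    identityʳ : ∀ {A B} {f : A ⇒ B} → f ∘ id ≈ f
    ∘-resp-≈  : ∀ {A B C} {f h : B ⇒ C} {g i : A ⇒ B} →
                f ≈ h → g ≈ i → f ∘ g ≈ h ∘ i

  module Eq {A B} = IsEquivalence (equiv {A} {B})

  tr : ∀ {X X' Y Y'} → X ≡ X' → Y ≡ Y' → X ⇒ Y → X' ⇒ Y'
  tr refl refl f = f

  tr-resp : ∀ {X X' Y Y'} (p : X ≡ X') (q : Y ≡ Y') {f g : X ⇒ Y} →
            f ≈ g → tr p q f ≈ tr p q g
  tr-resp refl refl r = r

  tr-∘ : ∀ {X X' Y Y' Z Z'} (p : X ≡ X') (q : Y ≡ Y') (r : Z ≡ Z')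
         (g : Y ⇒ Z) (f : X ⇒ Y) → tr p r (g ∘ f) ≡ tr q r g ∘ tr p q f
  tr-∘ refl refl refl g f = refl

  tr-id : ∀ {X X'} (p : X ≡ X') → tr p p (id {X}) ≡ id
  tr-id refl = refl

record Functor {o ℓ e o' ℓ' e'} (C : Category o ℓ e) (D : Category o' ℓ' e')
       : Set (o ⊔ ℓ ⊔ e ⊔ o' ⊔ ℓ' ⊔ e') where
  private
    module C = Category C
    module D = Category D
  field
    F₀ : C.Obj → D.Obj
    F₁ : ∀ {A B} → A C.⇒ B → F₀ A D.⇒ F₀ B
    identity     : ∀ {A} → F₁ (C.id {A}) D.≈ D.id
    homomorphism : ∀ {A B C'} {f : A C.⇒ B} {g : B C.⇒ C'} →
                   F₁ (g C.∘ f) D.≈ F₁ g D.∘ F₁ f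
    F-resp-≈     : ∀ {A B} {f g : A C.⇒ B} → f C.≈ g → F₁ f D.≈ F₁ g

module _ {o₁ ℓ₁ e₁ o ℓ e} {E : Category o₁ ℓ₁ e₁} {B : Category o ℓ e}
         (U : Functor E B) where
  private
    module E = Category E
    module B = Category B
    open Functor U

  Over : ∀ {P Q X Y} → F₀ P ≡ X → F₀ Q ≡ Y → P E.⇒ Q → X B.⇒ Y → Set e
  Over p q f u = B.tr p q (F₁ f) B.≈ u

  IsCartesian : ∀ {P Q} → P E.⇒ Q → Set (o₁ ⊔ ℓ₁ ⊔ e₁ ⊔ ℓ ⊔ e)
  IsCartesian {P} {Q} f =
    ∀ {R} (g : R E.⇒ Q) (h : F₀ R B.⇒ F₀ P) → F₁ g B.≈ F₁ f B.∘ h →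
    Σ[ k ∈ R E.⇒ P ] ((f E.∘ k E.≈ g × F₁ k B.≈ h) ×
      (∀ (k' : R E.⇒ P) → f E.∘ k' E.≈ g → F₁ k' B.≈ h → k' E.≈ k))

  IsFibration : Set (o₁ ⊔ ℓ₁ ⊔ e₁ ⊔ o ⊔ ℓ ⊔ e)
  IsFibration = ∀ {X} (Q : E.Obj) (u : X B.⇒ F₀ Q) →
    Σ[ P ∈ E.Obj ] Σ[ f ∈ P E.⇒ Q ] Σ[ p ∈ F₀ P ≡ X ]
      (Over p refl f u × IsCartesian f)

  IsFibreTerminal : (X : B.Obj) (T : E.Obj) → F₀ T ≡ X → Set (o₁ ⊔ ℓ₁ ⊔ e₁ ⊔ o ⊔ e)
  IsFibreTerminal X T q = ∀ (P : E.Obj) (p : F₀ P ≡ X) →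
    Σ[ ! ∈ P E.⇒ T ] (Over p q ! B.id ×
      (∀ (g : P E.⇒ T) → Over p q g B.id → g E.≈ !))

  HasFibredTerminals : Set (o₁ ⊔ ℓ₁ ⊔ e₁ ⊔ o ⊔ ℓ ⊔ e)
  HasFibredTerminals =
    (∀ (X : B.Obj) → Σ[ T ∈ E.Obj ] Σ[ q ∈ F₀ T ≡ X ] IsFibreTerminal X T q) ×
    (∀ {P Q} (f : P E.⇒ Q) → IsCartesian f →
       IsFibreTerminal (F₀ Q) Q refl → IsFibreTerminal (F₀ P) P refl)

  IsTruthFunctor : Functor B E → Set (o₁ ⊔ ℓ₁ ⊔ e₁ ⊔ o ⊔ ℓ ⊔ e)
  IsTruthFunctor K =
    Σ[ q ∈ (∀ X → F₀ (Functor.F₀ K X) ≡ X) ]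
      ((∀ X → IsFibreTerminal X (Functor.F₀ K X) (q X)) ×
       (∀ {X Y} (u : X B.⇒ Y) → Over (q X) (q Y) (Functor.F₁ K u) u))

module _ {o ℓ e o' ℓ' e'} {C : Category o ℓ e} {D : Category o' ℓ' e'} where
  private
    module C = Category C
    module D = Category D

  HasRightAdjoint : Functor C D → Set (o ⊔ ℓ ⊔ e ⊔ o' ⊔ ℓ' ⊔ e')
  HasRightAdjoint K =
    Σ[ R ∈ Functor D C ]
    Σ[ η ∈ (∀ X → X C.⇒ Functor.F₀ R (K₀ X)) ]
    Σ[ ε ∈ (∀ P → K₀ (Functor.F₀ R P) D.⇒ P) ]
      ((∀ {X Y} (u : X C.⇒ Y) →
          Functor.F₁ R (K₁ u) C.∘ η X C.≈ η Y C.∘ u) ×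
       (∀ {P Q} (f : P D.⇒ Q) →
          f D.∘ ε P D.≈ ε Q D.∘ K₁ (Functor.F₁ R f)) ×
       (∀ X → ε (K₀ X) D.∘ K₁ (η X) D.≈ D.id) ×
       (∀ P → Functor.F₁ R (ε P) C.∘ η (Functor.F₀ R P) C.≈ C.id))
    where
      open Functor K renaming (F₀ to K₀; F₁ to K₁)

record IsCCU {o₁ ℓ₁ e₁ o ℓ e} {E : Category o₁ ℓ₁ e₁} {B : Category o ℓ e}
             (U : Functor E B) : Set (o₁ ⊔ ℓ₁ ⊔ e₁ ⊔ o ⊔ ℓ ⊔ e) where
  field
    fibration       : IsFibration U
    fibredTerminals : HasFibredTerminals U
    K               : Functor B E
    K-truth         : IsTruthFunctor U K
    K-rightAdjoint  : HasRightAdjoint K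

module _ {o₁ ℓ₁ e₁ o₂ ℓ₂ e₂ o ℓ e}
         {E : Category o₁ ℓ₁ e₁} {E' : Category o₂ ℓ₂ e₂} {B : Category o ℓ e}
         (U : Functor E B) (U' : Functor E' B) where
  private
    module E = Category E
    module E' = Category E'
    module B = Category B
    module U = Functor U
    module U' = Functor U'

  PbObj : Set (o₁ ⊔ o₂ ⊔ o)
  PbObj = Σ[ P' ∈ E'.Obj ] Σ[ P ∈ E.Obj ] U'.F₀ P' ≡ U.F₀ P

  record PbHom (A A' : PbObj) : Set (ℓ₁ ⊔ ℓ₂ ⊔ e) where
    constructor pbhom
    field
      f' : proj₁ A E'.⇒ proj₁ A'
      f  : proj₁ (proj₂ A) E.⇒ proj₁ (proj₂ A')
      eq : B.tr (proj₂ (proj₂ A)) (proj₂ (proj₂ A')) (U'.F₁ f') B.≈ U.F₁ f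
  open PbHom

  private
    pb-id : ∀ {A} → PbHom A A
    pb-id {P' , P , p} = pbhom E'.id E.id
      (B.Eq.trans (B.tr-resp p p U'.identity)
        (Relation.Binary.PropositionalEquality.subst
           (λ z → z B.≈ U.F₁ E.id) (Relation.Binary.PropositionalEquality.sym (B.tr-id p))
           (B.Eq.sym U.identity)))

    pb-∘ : ∀ {A A' A''} → PbHom A' A'' → PbHom A A' → PbHom A A''
    pb-∘ {_ , _ , p} {_ , _ , q} {_ , _ , r} (pbhom g' g eg) (pbhom f' f ef) =
      pbhom (g' E'.∘ f') (g E.∘ f)
        (B.Eq.trans (B.tr-resp p r U'.homomorphism)
        (Relation.Binary.PropositionalEquality.subst
           (λ z → z B.≈ U.F₁ (g E.∘ f))
           (Relation.Binary.PropositionalEquality.sym (B.tr-∘ p q r (U'.F₁ g') (U'.F₁ f')))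
           (B.Eq.trans (B.∘-resp-≈ eg ef) (B.Eq.sym U.homomorphism))))

  PullbackCat : Category (o₁ ⊔ o₂ ⊔ o) (ℓ₁ ⊔ ℓ₂ ⊔ e) (e₁ ⊔ e₂)
  PullbackCat = record
    { Obj = PbObj
    ; _⇒_ = PbHom
    ; _≈_ = λ h k → (f' h E'.≈ f' k) × (f h E.≈ f k)
    ; id = pb-id
    ; _∘_ = pb-∘
    ; equiv = record
      { refl = E'.Eq.refl , E.Eq.refl
      ; sym = λ (a , b) → E'.Eq.sym a , E.Eq.sym b
      ; trans = λ (a , b) (c , d) → E'.Eq.trans a c , E.Eq.trans b d }
    ; assoc = E'.assoc , E.assoc
    ; identityˡ = E'.identityˡ , E.identityˡ
    ; identityʳ = E'.identityʳ , E.identityʳ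
    ; ∘-resp-≈ = λ (a , b) (c , d) → E'.∘-resp-≈ a c , E.∘-resp-≈ b d
    }

  PullbackFunctor : Functor PullbackCat E'
  PullbackFunctor = record
    { F₀ = proj₁
    ; F₁ = f'
    ; identity = E'.Eq.refl
    ; homomorphism = E'.Eq.refl
    ; F-resp-≈ = proj₁
    }

-- Everything in U'^*E is componentwise, U' only constraining the first component.  A pair
-- (u, c) with c U-cartesian is cartesian, so u is lifted by pairing it with a U-cartesian lift
-- of U'u.  The terminal object over X' is (X', T) with T terminal over U'X'; a cartesian
-- (f', f) into a terminal object is compared with (f', c ∘ !), where c is a U-cartesian lift
-- of U'f' and its domain is terminal because U has fibred terminals.  The truth functor is
-- X ↦ (X, K (U'X)).  Its right adjoint sends (P', P) to the domain of a U'-cartesian lift,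
-- with codomain P', of U ε_P : R P → U P = U'P'; its action on morphisms, the unit and the
-- counit are induced from K ⊣ R by the universal property of these lifts.

module Submission where

open import Data.Product using (_,_; proj₁; proj₂)
open import Relation.Binary.Bundles using (Setoid)
open import Relation.Binary.PropositionalEquality using (_≡_; refl; sym; trans)
import Relation.Binary.Reasoning.Setoid as SetoidReasoning
open import Defs

module CategoryProps {o ℓ e} (C : Category o ℓ e) where
  open Category C

  hom-setoid : Obj → Obj → Setoid ℓ e
  hom-setoid X Y = record { Carrier = X ⇒ Y ; _≈_ = _≈_ ; isEquivalence = equiv }

  module HomReasoning {X Y : Obj} = SetoidReasoning (hom-setoid X Y)

  tr-transpose : ∀ {X X' Y Y'} (p : X ≡ X') (q : Y ≡ Y') {f : X ⇒ Y} {g : X' ⇒ Y'} →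
                 tr p q f ≈ g → tr (sym p) (sym q) g ≈ f
  tr-transpose refl refl f≈g = Eq.sym f≈g

  extendʳ : ∀ {W X X' Y Z} {c : X ⇒ Z} {x : Y ⇒ X} {y : X' ⇒ Z} {c' : Y ⇒ X'} {x' : W ⇒ Y} →
            c ∘ x ≈ y ∘ c' → c ∘ (x ∘ x') ≈ y ∘ (c' ∘ x')
  extendʳ sq = Eq.trans (Eq.sym assoc) (Eq.trans (∘-resp-≈ sq Eq.refl) assoc)

module FibrationProps {o₁ ℓ₁ e₁ o ℓ e} {E : Category o₁ ℓ₁ e₁} {B : Category o ℓ e}
                      (U : Functor E B) where
  private
    module E = Category E
    module B = Category B
  open Functor U

  module _ {P Q} {f : P E.⇒ Q} (f-cart : IsCartesian U f)
           {R} (g : R E.⇒ Q) (h : F₀ R B.⇒ F₀ P) (g-over : F₁ g B.≈ F₁ f B.∘ h) where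

    factor : R E.⇒ P
    factor = proj₁ (f-cart g h g-over)

    factor-commutes : f E.∘ factor E.≈ g
    factor-commutes = proj₁ (proj₁ (proj₂ (f-cart g h g-over)))

    factor-over : F₁ factor B.≈ h
    factor-over = proj₂ (proj₁ (proj₂ (f-cart g h g-over)))

    factor-unique : ∀ k → f E.∘ k E.≈ g → F₁ k B.≈ h → k E.≈ factor
    factor-unique = proj₂ (proj₂ (f-cart g h g-over))

  cartesian-unique : ∀ {P Q} {f : P E.⇒ Q} → IsCartesian U f →
                     ∀ {R} {g : R E.⇒ Q} {h : F₀ R B.⇒ F₀ P} (k k' : R E.⇒ P) →
                     f E.∘ k E.≈ g → F₁ k B.≈ h → f E.∘ k' E.≈ g → F₁ k' B.≈ h → k E.≈ k'
  cartesian-unique {f = f} f-cart {g = g} {h} k k' fk≈g k-over fk'≈g k'-over =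
    E.Eq.trans (factor-unique f-cart g h g-over k fk≈g k-over)
               (E.Eq.sym (factor-unique f-cart g h g-over k' fk'≈g k'-over))
    where
      open CategoryProps.HomReasoning B

      g-over : F₁ g B.≈ F₁ f B.∘ h
      g-over = begin
        F₁ g             ≈⟨ F-resp-≈ fk≈g ⟨
        F₁ (f E.∘ k)     ≈⟨ homomorphism ⟩
        F₁ f B.∘ F₁ k    ≈⟨ B.∘-resp-≈ B.Eq.refl k-over ⟩
        F₁ f B.∘ h       ∎

  module Lift (fib : IsFibration U) {X} (Q : E.Obj) (u : X B.⇒ F₀ Q) where

    dom : E.Obj
    dom = proj₁ (fib Q u)

    arr : dom E.⇒ Q
    arr = proj₁ (proj₂ (fib Q u))

    dom-over : F₀ dom ≡ X
    dom-over = proj₁ (proj₂ (proj₂ (fib Q u)))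

    arr-over : Over U dom-over refl arr u
    arr-over = proj₁ (proj₂ (proj₂ (proj₂ (fib Q u))))

    arr-cartesian : IsCartesian U arr
    arr-cartesian = proj₂ (proj₂ (proj₂ (proj₂ (fib Q u))))

  module FibreTerminal {X T} {t : F₀ T ≡ X} (T-term : IsFibreTerminal U X T t)
                       (P : E.Obj) (p : F₀ P ≡ X) where

    ! : P E.⇒ T
    ! = proj₁ (T-term P p)

    !-over : Over U p t ! B.id
    !-over = proj₁ (proj₂ (T-term P p))

    !-unique : ∀ g → Over U p t g B.id → g E.≈ !
    !-unique = proj₂ (proj₂ (T-term P p))

module Pullback {o₁ ℓ₁ e₁ o₂ ℓ₂ e₂ o ℓ e}
  {E : Category o₁ ℓ₁ e₁} {E' : Category o₂ ℓ₂ e₂} {B : Category o ℓ e}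
  (U : Functor E B) (U' : Functor E' B) where
  private
    module E = Category E
    module E' = Category E'
    module B = Category B
    module U = Functor U
    module U' = Functor U'
    module U'*E = Category (PullbackCat U U')
    module FU = FibrationProps U
    module FU* = FibrationProps (PullbackFunctor U U')
  open CategoryProps B

  U'*U : Functor (PullbackCat U U') E'
  U'*U = PullbackFunctor U U'

  pair-cartesian : ∀ {A A'} (h : PbHom U U' A A') → IsCartesian U (PbHom.f h) → IsCartesian U'*U h
  pair-cartesian {P' , P , p} {Q' , Q , q} (pbhom f' f f-eq) f-cart
                 {R' , R , r} (pbhom g' g g-eq) k' g'≈f'k' =
    pbhom k' k k-eq , ((E'.Eq.sym g'≈f'k' , FU.factor-commutes f-cart g kB g-over) , E'.Eq.refl) , unique
    where
      open HomReasoning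

      kB : U.F₀ R B.⇒ U.F₀ P
      kB = B.tr r p (U'.F₁ k')

      g-over : U.F₁ g B.≈ U.F₁ f B.∘ kB
      g-over = begin
        U.F₁ g                              ≈⟨ g-eq ⟨
        B.tr r q (U'.F₁ g')                 ≈⟨ B.tr-resp r q (U'.F-resp-≈ g'≈f'k') ⟩
        B.tr r q (U'.F₁ (f' E'.∘ k'))       ≈⟨ B.tr-resp r q U'.homomorphism ⟩
        B.tr r q (U'.F₁ f' B.∘ U'.F₁ k')    ≡⟨ B.tr-∘ r p q (U'.F₁ f') (U'.F₁ k') ⟩
        B.tr p q (U'.F₁ f') B.∘ kB          ≈⟨ B.∘-resp-≈ f-eq B.Eq.refl ⟩
        U.F₁ f B.∘ kB                       ∎

      k : R E.⇒ P
      k = FU.factor f-cart g kB g-over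

      k-eq : kB B.≈ U.F₁ k
      k-eq = B.Eq.sym (FU.factor-over f-cart g kB g-over)

      unique : ∀ (l : PbHom U U' (R' , R , r) (P' , P , p)) →
               pbhom f' f f-eq U'*E.∘ l U'*E.≈ pbhom g' g g-eq → PbHom.f' l E'.≈ k' →
               l U'*E.≈ pbhom k' k k-eq
      unique (pbhom l' l l-eq) (_ , fl≈g) l'≈k' =
        l'≈k' , FU.factor-unique f-cart g kB g-over l fl≈g
                  (B.Eq.trans (B.Eq.sym l-eq) (B.tr-resp r p (U'.F-resp-≈ l'≈k')))

  pullback-fibration : IsFibration U → IsFibration U'*U
  pullback-fibration fib {X'} (Q' , Q , q) u =
    (X' , L.dom , sym L.dom-over) , arr* , refl , E'.Eq.refl , pair-cartesian arr* L.arr-cartesian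
    where
      module L = FU.Lift fib Q (B.tr refl q (U'.F₁ u))

      -- Objects of B are compared by ≡: this and the other transport lemmas below generalise
      -- the identifications involved so that they can be matched with refl.
      transpose-over : ∀ {X Y X' Y'} (s : X ≡ X') (q : Y ≡ Y') {c : X B.⇒ Y'} {v : X' B.⇒ Y} →
                       B.tr s refl c B.≈ B.tr refl q v → B.tr (sym s) q v B.≈ c
      transpose-over refl refl c≈v = B.Eq.sym c≈v

      arr* : PbHom U U' (X' , L.dom , sym L.dom-over) (Q' , Q , q)
      arr* = pbhom u L.arr (transpose-over L.dom-over q L.arr-over)

  pair-fibreTerminal : ∀ {X' T} (t : U.F₀ T ≡ U'.F₀ X') → IsFibreTerminal U (U'.F₀ X') T t →
                       IsFibreTerminal U'*U X' (X' , T , sym t) refl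
  pair-fibreTerminal {X'} {T} t T-term (.X' , P , p) refl = pbhom E'.id T.! !-eq , E'.Eq.refl , unique
    where
      module T = FU.FibreTerminal T-term P (sym p)

      transpose-id : ∀ {X X' Y} (p : X ≡ X') (t : Y ≡ X) {m : X' B.⇒ Y} →
                     B.tr (sym p) t m B.≈ B.id → B.tr p (sym t) B.id B.≈ m
      transpose-id refl refl m≈id = B.Eq.sym m≈id

      transpose-id⁻¹ : ∀ {X X' Y} (p : X ≡ X') (t : Y ≡ X) {x : X B.⇒ X} {m : X' B.⇒ Y} →
                       B.tr p (sym t) x B.≈ m → x B.≈ B.id → B.tr (sym p) t m B.≈ B.id
      transpose-id⁻¹ refl refl x≈m x≈id = B.Eq.trans (B.Eq.sym x≈m) x≈id

      !-eq : B.tr p (sym t) (U'.F₁ E'.id) B.≈ U.F₁ T.!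
      !-eq = B.Eq.trans (B.tr-resp p (sym t) U'.identity) (transpose-id p t T.!-over)

      unique : ∀ (g : PbHom U U' (X' , P , p) (X' , T , sym t)) → PbHom.f' g E'.≈ E'.id →
               g U'*E.≈ pbhom E'.id T.! !-eq
      unique (pbhom g' g g-eq) g'≈id =
        g'≈id , T.!-unique g (transpose-id⁻¹ p t g-eq (B.Eq.trans (U'.F-resp-≈ g'≈id) U'.identity))

  second-fibreTerminal : ∀ {Q' Q} (q : U'.F₀ Q' ≡ U.F₀ Q) →
                         IsFibreTerminal U'*U Q' (Q' , Q , q) refl → IsFibreTerminal U (U.F₀ Q) Q refl
  second-fibreTerminal {Q'} {Q} q A-term R ρ =
    PbHom.f T.! , realign q ρ (PbHom.eq T.!) U'!≈id , unique
    where
      module T = FU*.FibreTerminal A-term (Q' , R , trans q (sym ρ)) refl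

      realign : ∀ {X Y Z} (q : X ≡ Y) (ρ : Z ≡ Y) {x : X B.⇒ X} {m : Z B.⇒ Y} →
                B.tr (trans q (sym ρ)) q x B.≈ m → x B.≈ B.id → B.tr ρ refl m B.≈ B.id
      realign refl refl x≈m x≈id = B.Eq.trans (B.Eq.sym x≈m) x≈id

      realign⁻¹ : ∀ {X Y Z} (q : X ≡ Y) (ρ : Z ≡ Y) {x : X B.⇒ X} {m : Z B.⇒ Y} →
                  x B.≈ B.id → B.tr ρ refl m B.≈ B.id → B.tr (trans q (sym ρ)) q x B.≈ m
      realign⁻¹ refl refl x≈id m≈id = B.Eq.trans x≈id (B.Eq.sym m≈id)

      U'!≈id : U'.F₁ (PbHom.f' T.!) B.≈ B.id
      U'!≈id = B.Eq.trans (U'.F-resp-≈ T.!-over) U'.identity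

      unique : ∀ (g : R E.⇒ Q) → B.tr ρ refl (U.F₁ g) B.≈ B.id → g E.≈ PbHom.f T.!
      unique g g-over = proj₂ (T.!-unique (pbhom E'.id g (realign⁻¹ q ρ U'.identity g-over)) E'.Eq.refl)

  reindex-fibreTerminal : IsFibration U → HasFibredTerminals U →
                          ∀ {A A'} (h : PbHom U U' A A') → IsCartesian U'*U h →
                          IsFibreTerminal U'*U (proj₁ A') A' refl → IsFibreTerminal U'*U (proj₁ A) A refl
  reindex-fibreTerminal fib fibred-terminals {P' , P , p} {Q' , Q , q} h@(pbhom f' f f-eq) h-cart A'-term
                        (.P' , R , r) refl =
    k , FU*.factor-over {f = h} h-cart G E'.id G-over , unique
    where
      open HomReasoning

      u : U.F₀ R B.⇒ U.F₀ Q
      u = B.tr r q (U'.F₁ f')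

      module L = FU.Lift fib Q u

      S-term : IsFibreTerminal U (U.F₀ L.dom) L.dom refl
      S-term = proj₂ fibred-terminals L.arr L.arr-cartesian (second-fibreTerminal q A'-term)

      module S = FU.FibreTerminal S-term R (sym L.dom-over)

      factor-over-id : ∀ {X X' Y} (s : X ≡ X') {c : X B.⇒ Y} {d : X' B.⇒ X} {v : X' B.⇒ Y} →
                       B.tr s refl c B.≈ v → B.tr (sym s) refl d B.≈ B.id → v B.≈ c B.∘ d
      factor-over-id refl c≈v d≈id =
        B.Eq.trans (B.Eq.sym c≈v)
          (B.Eq.trans (B.Eq.sym B.identityʳ) (B.∘-resp-≈ B.Eq.refl (B.Eq.sym d≈id)))

      u≈arr∘! : u B.≈ U.F₁ L.arr B.∘ U.F₁ S.!
      u≈arr∘! = factor-over-id L.dom-over L.arr-over S.!-over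

      G : PbHom U U' (P' , R , r) (Q' , Q , q)
      G = pbhom f' (L.arr E.∘ S.!) (B.Eq.trans u≈arr∘! (B.Eq.sym U.homomorphism))

      G-over : f' E'.≈ f' E'.∘ E'.id
      G-over = E'.Eq.sym E'.identityʳ

      k : PbHom U U' (P' , R , r) (P' , P , p)
      k = FU*.factor {f = h} h-cart G E'.id G-over

      unique : ∀ (l : PbHom U U' (P' , R , r) (P' , P , p)) → PbHom.f' l E'.≈ E'.id → l U'*E.≈ k
      unique (pbhom l' l l-eq) l'≈id =
        FU*.factor-unique {f = h} h-cart G E'.id G-over (pbhom l' l l-eq) (f'l'≈f' , fl≈arr∘!) l'≈id
        where
          f'l'≈f' : f' E'.∘ l' E'.≈ f'
          f'l'≈f' = E'.Eq.trans (E'.∘-resp-≈ E'.Eq.refl l'≈id) E'.identityʳ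

          fl-over : U.F₁ (f E.∘ l) B.≈ U.F₁ L.arr B.∘ U.F₁ S.!
          fl-over = begin
            U.F₁ (f E.∘ l)                            ≈⟨ U.homomorphism ⟩
            U.F₁ f B.∘ U.F₁ l                         ≈⟨ B.∘-resp-≈ f-eq l-eq ⟨
            B.tr p q (U'.F₁ f') B.∘ B.tr r p (U'.F₁ l') ≡⟨ B.tr-∘ r p q (U'.F₁ f') (U'.F₁ l') ⟨
            B.tr r q (U'.F₁ f' B.∘ U'.F₁ l')          ≈⟨ B.tr-resp r q U'.homomorphism ⟨
            B.tr r q (U'.F₁ (f' E'.∘ l'))             ≈⟨ B.tr-resp r q (U'.F-resp-≈ f'l'≈f') ⟩
            u                                         ≈⟨ u≈arr∘! ⟩
            U.F₁ L.arr B.∘ U.F₁ S.!                   ∎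

          m : R E.⇒ L.dom
          m = FU.factor L.arr-cartesian (f E.∘ l) (U.F₁ S.!) fl-over

          m≈! : m E.≈ S.!
          m≈! = S.!-unique m (B.Eq.trans (B.tr-resp (sym L.dom-over) refl
                  (FU.factor-over L.arr-cartesian (f E.∘ l) (U.F₁ S.!) fl-over)) S.!-over)

          fl≈arr∘! : f E.∘ l E.≈ L.arr E.∘ S.!
          fl≈arr∘! =
            E.Eq.trans (E.Eq.sym (FU.factor-commutes L.arr-cartesian (f E.∘ l) (U.F₁ S.!) fl-over))
                       (E.∘-resp-≈ E.Eq.refl m≈!)

  pullback-fibredTerminals : IsFibration U → HasFibredTerminals U → HasFibredTerminals U'*U
  pullback-fibredTerminals fib fibred-terminals =
    (λ X' → let (T , t , T-term) = proj₁ fibred-terminals (U'.F₀ X')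
            in (X' , T , sym t) , refl , pair-fibreTerminal t T-term)
    , reindex-fibreTerminal fib fibred-terminals

  module Truth (K : Functor B E) (K-truth : IsTruthFunctor U K) where
    module K = Functor K

    K-over : ∀ X → U.F₀ (K.F₀ X) ≡ X
    K-over = proj₁ K-truth

    K-terminal : ∀ X → IsFibreTerminal U X (K.F₀ X) (K-over X)
    K-terminal = proj₁ (proj₂ K-truth)

    K₁-over : ∀ {X Y} (u : X B.⇒ Y) → Over U (K-over X) (K-over Y) (K.F₁ u) u
    K₁-over = proj₂ (proj₂ K-truth)

    K*₀ : E'.Obj → PbObj U U'
    K*₀ X = X , K.F₀ (U'.F₀ X) , sym (K-over (U'.F₀ X))

    K*₁ : ∀ {X Y} → X E'.⇒ Y → PbHom U U' (K*₀ X) (K*₀ Y)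
    K*₁ u = pbhom u (K.F₁ (U'.F₁ u)) (tr-transpose (K-over _) (K-over _) (K₁-over (U'.F₁ u)))

    K* : Functor E' (PullbackCat U U')
    K* = record
      { F₀ = K*₀
      ; F₁ = K*₁
      ; identity = E'.Eq.refl , E.Eq.trans (K.F-resp-≈ U'.identity) K.identity
      ; homomorphism = E'.Eq.refl , E.Eq.trans (K.F-resp-≈ U'.homomorphism) K.homomorphism
      ; F-resp-≈ = λ u≈v → u≈v , K.F-resp-≈ (U'.F-resp-≈ u≈v)
      }

    pullback-truth : IsTruthFunctor U'*U K*
    pullback-truth =
      (λ _ → refl) , (λ X → pair-fibreTerminal (K-over _) (K-terminal (U'.F₀ X))) , (λ _ → E'.Eq.refl)

  module RightAdjoint (fib' : IsFibration U') (K : Functor B E) (K-truth : IsTruthFunctor U K)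
                      (K⊣R : HasRightAdjoint K) where
    open Truth K K-truth
    private
      module FU' = FibrationProps U'

    R : Functor E B
    R = proj₁ K⊣R

    module R = Functor R

    η : ∀ X → X B.⇒ R.F₀ (K.F₀ X)
    η = proj₁ (proj₂ K⊣R)

    ε : ∀ P → K.F₀ (R.F₀ P) E.⇒ P
    ε = proj₁ (proj₂ (proj₂ K⊣R))

    η-natural : ∀ {X Y} (u : X B.⇒ Y) → R.F₁ (K.F₁ u) B.∘ η X B.≈ η Y B.∘ u
    η-natural = proj₁ (proj₂ (proj₂ (proj₂ K⊣R)))

    ε-natural : ∀ {P Q} (f : P E.⇒ Q) → f E.∘ ε P E.≈ ε Q E.∘ K.F₁ (R.F₁ f)
    ε-natural = proj₁ (proj₂ (proj₂ (proj₂ (proj₂ K⊣R))))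

    zig : ∀ X → ε (K.F₀ X) E.∘ K.F₁ (η X) E.≈ E.id
    zig = proj₁ (proj₂ (proj₂ (proj₂ (proj₂ (proj₂ K⊣R)))))

    zag : ∀ P → R.F₁ (ε P) B.∘ η (R.F₀ P) B.≈ B.id
    zag = proj₂ (proj₂ (proj₂ (proj₂ (proj₂ (proj₂ K⊣R)))))

    -- U (K (R P)) ≡ R P and U P ≡ U'P' turn U ε_P into a morphism R P → U'P'.
    π : (A : PbObj U U') → R.F₀ (proj₁ (proj₂ A)) B.⇒ U'.F₀ (proj₁ A)
    π (_ , P , a) = B.tr (K-over (R.F₀ P)) (sym a) (U.F₁ (ε P))

    module L (A : PbObj U U') = FU'.Lift fib' (proj₁ A) (π A)

    R*₀ : PbObj U U' → E'.Obj
    R*₀ = L.dom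

    R-over : ∀ {A₁ A₂} → PbHom U U' A₁ A₂ → U'.F₀ (R*₀ A₁) B.⇒ U'.F₀ (R*₀ A₂)
    R-over {A₁} {A₂} h = B.tr (sym (L.dom-over A₁)) (sym (L.dom-over A₂)) (R.F₁ (PbHom.f h))

    arr-square : ∀ {A₁ A₂} (h : PbHom U U' A₁ A₂) →
                 U'.F₁ (PbHom.f' h E'.∘ L.arr A₁) B.≈ U'.F₁ (L.arr A₂) B.∘ R-over h
    arr-square {A₁@(_ , P₁ , a₁)} {A₂@(_ , P₂ , a₂)} (pbhom f' f f-eq) =
      B.Eq.trans U'.homomorphism
        (transported-square (L.dom-over A₁) (L.dom-over A₂) (K-over _) (K-over _) a₁ a₂
          (L.arr-over A₁) (L.arr-over A₂) f-eq ε-square (K₁-over (R.F₁ f)))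
      where
        open HomReasoning

        ε-square : U.F₁ f B.∘ U.F₁ (ε P₁) B.≈ U.F₁ (ε P₂) B.∘ U.F₁ (K.F₁ (R.F₁ f))
        ε-square = begin
          U.F₁ f B.∘ U.F₁ (ε P₁)                 ≈⟨ U.homomorphism ⟨
          U.F₁ (f E.∘ ε P₁)                      ≈⟨ U.F-resp-≈ (ε-natural f) ⟩
          U.F₁ (ε P₂ E.∘ K.F₁ (R.F₁ f))          ≈⟨ U.homomorphism ⟩
          U.F₁ (ε P₂) B.∘ U.F₁ (K.F₁ (R.F₁ f))   ∎

        transported-square :
          ∀ {X₁ X₂ Y₁ Y₂ Z₁ Z₂ W₁ W₂ V₁ V₂} (z₁ : Z₁ ≡ V₁) (z₂ : Z₂ ≡ V₂)
          (k₁ : W₁ ≡ V₁) (k₂ : W₂ ≡ V₂) (a₁ : X₁ ≡ Y₁) (a₂ : X₂ ≡ Y₂)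
          {f' : X₁ B.⇒ X₂} {f : Y₁ B.⇒ Y₂} {c₁ : Z₁ B.⇒ X₁} {c₂ : Z₂ B.⇒ X₂}
          {e₁ : W₁ B.⇒ Y₁} {e₂ : W₂ B.⇒ Y₂} {kr : W₁ B.⇒ W₂} {r : V₁ B.⇒ V₂} →
          B.tr z₁ refl c₁ B.≈ B.tr k₁ (sym a₁) e₁ → B.tr z₂ refl c₂ B.≈ B.tr k₂ (sym a₂) e₂ →
          B.tr a₁ a₂ f' B.≈ f → f B.∘ e₁ B.≈ e₂ B.∘ kr → B.tr k₁ k₂ kr B.≈ r →
          f' B.∘ c₁ B.≈ c₂ B.∘ B.tr (sym z₁) (sym z₂) r
        transported-square refl refl refl refl refl refl c₁≈e₁ c₂≈e₂ f'≈f sq kr≈r =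
          B.Eq.trans (B.∘-resp-≈ f'≈f c₁≈e₁) (B.Eq.trans sq (B.∘-resp-≈ (B.Eq.sym c₂≈e₂) kr≈r))

    R*₁ : ∀ {A₁ A₂} → PbHom U U' A₁ A₂ → R*₀ A₁ E'.⇒ R*₀ A₂
    R*₁ {A₁} {A₂} h =
      FU'.factor (L.arr-cartesian A₂) (PbHom.f' h E'.∘ L.arr A₁) (R-over h) (arr-square h)

    R*₁-commutes : ∀ {A₁ A₂} (h : PbHom U U' A₁ A₂) →
                   L.arr A₂ E'.∘ R*₁ h E'.≈ PbHom.f' h E'.∘ L.arr A₁
    R*₁-commutes {A₁} {A₂} h =
      FU'.factor-commutes (L.arr-cartesian A₂) (PbHom.f' h E'.∘ L.arr A₁) (R-over h) (arr-square h)

    R*₁-over : ∀ {A₁ A₂} (h : PbHom U U' A₁ A₂) → U'.F₁ (R*₁ h) B.≈ R-over h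
    R*₁-over {A₁} {A₂} h =
      FU'.factor-over (L.arr-cartesian A₂) (PbHom.f' h E'.∘ L.arr A₁) (R-over h) (arr-square h)

    R*₁-identity : ∀ {A} → R*₁ (U'*E.id {A}) E'.≈ E'.id
    R*₁-identity {A} =
      FU'.cartesian-unique (L.arr-cartesian A) (R*₁ U'*E.id) E'.id
        (R*₁-commutes U'*E.id) (R*₁-over U'*E.id)
        (E'.Eq.trans E'.identityʳ (E'.Eq.sym E'.identityˡ))
        (B.Eq.trans U'.identity
          (B.Eq.sym (B.Eq.trans (B.tr-resp _ _ R.identity) (B.Eq.reflexive (B.tr-id _)))))

    R*₁-homomorphism : ∀ {A₁ A₂ A₃} {h : PbHom U U' A₁ A₂} {h' : PbHom U U' A₂ A₃} →
                       R*₁ (h' U'*E.∘ h) E'.≈ R*₁ h' E'.∘ R*₁ h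
    R*₁-homomorphism {A₁} {A₂} {A₃} {h} {h'} =
      FU'.cartesian-unique (L.arr-cartesian A₃) (R*₁ (h' U'*E.∘ h)) (R*₁ h' E'.∘ R*₁ h)
        (R*₁-commutes (h' U'*E.∘ h)) (R*₁-over (h' U'*E.∘ h))
        (E'.Eq.trans (CategoryProps.extendʳ E' (R*₁-commutes h'))
          (E'.Eq.trans (E'.∘-resp-≈ E'.Eq.refl (R*₁-commutes h)) (E'.Eq.sym E'.assoc)))
        composite-over
      where
        open HomReasoning

        z₁ : R.F₀ (proj₁ (proj₂ A₁)) ≡ U'.F₀ (R*₀ A₁)
        z₁ = sym (L.dom-over A₁)

        z₃ : R.F₀ (proj₁ (proj₂ A₃)) ≡ U'.F₀ (R*₀ A₃)
        z₃ = sym (L.dom-over A₃)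

        composite-over : U'.F₁ (R*₁ h' E'.∘ R*₁ h) B.≈ R-over (h' U'*E.∘ h)
        composite-over = begin
          U'.F₁ (R*₁ h' E'.∘ R*₁ h)                                ≈⟨ U'.homomorphism ⟩
          U'.F₁ (R*₁ h') B.∘ U'.F₁ (R*₁ h)                         ≈⟨ B.∘-resp-≈ (R*₁-over h') (R*₁-over h) ⟩
          R-over h' B.∘ R-over h                                    ≡⟨ B.tr-∘ z₁ _ z₃ _ _ ⟨
          B.tr z₁ z₃ (R.F₁ (PbHom.f h') B.∘ R.F₁ (PbHom.f h))      ≈⟨ B.tr-resp z₁ z₃ R.homomorphism ⟨
          R-over (h' U'*E.∘ h)                                      ∎

    R*₁-resp-≈ : ∀ {A₁ A₂} {h h' : PbHom U U' A₁ A₂} → h U'*E.≈ h' → R*₁ h E'.≈ R*₁ h'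
    R*₁-resp-≈ {A₁} {A₂} {h} {h'} (f'≈ , f≈) =
      FU'.cartesian-unique (L.arr-cartesian A₂) (R*₁ h) (R*₁ h') (R*₁-commutes h) (R*₁-over h)
        (E'.Eq.trans (R*₁-commutes h') (E'.∘-resp-≈ (E'.Eq.sym f'≈) E'.Eq.refl))
        (B.Eq.trans (R*₁-over h') (B.tr-resp _ _ (R.F-resp-≈ (E.Eq.sym f≈))))

    R* : Functor (PullbackCat U U') E'
    R* = record
      { F₀ = R*₀
      ; F₁ = R*₁
      ; identity = R*₁-identity
      ; homomorphism = R*₁-homomorphism
      ; F-resp-≈ = R*₁-resp-≈
      }

    η-over : ∀ X → U'.F₀ X B.⇒ U'.F₀ (R*₀ (K*₀ X))
    η-over X = B.tr refl (sym (L.dom-over (K*₀ X))) (η (U'.F₀ X))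

    η-square : ∀ X → U'.F₁ E'.id B.≈ U'.F₁ (L.arr (K*₀ X)) B.∘ η-over X
    η-square X =
      transported-zig (L.dom-over (K*₀ X)) (K-over _) (K-over _)
        (L.arr-over (K*₀ X)) (K₁-over (η (U'.F₀ X))) U-zig U'.identity
      where
        U-zig : U.F₁ (ε (K.F₀ (U'.F₀ X))) B.∘ U.F₁ (K.F₁ (η (U'.F₀ X))) B.≈ B.id
        U-zig = B.Eq.trans (B.Eq.sym U.homomorphism) (B.Eq.trans (U.F-resp-≈ (zig _)) U.identity)

        transported-zig :
          ∀ {X Z W V T} (z : Z ≡ V) (k : W ≡ V) (kX : T ≡ X)
          {c : Z B.⇒ X} {e : W B.⇒ T} {kη : T B.⇒ W} {η : X B.⇒ V} {x : X B.⇒ X} →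
          B.tr z refl c B.≈ B.tr k (sym (sym kX)) e → B.tr kX k kη B.≈ η →
          e B.∘ kη B.≈ B.id → x B.≈ B.id → x B.≈ c B.∘ B.tr refl (sym z) η
        transported-zig refl refl refl c≈e kη≈η e∘kη≈id x≈id =
          B.Eq.trans x≈id (B.Eq.trans (B.Eq.sym e∘kη≈id) (B.∘-resp-≈ (B.Eq.sym c≈e) kη≈η))

    η* : ∀ X → X E'.⇒ R*₀ (K*₀ X)
    η* X = FU'.factor (L.arr-cartesian (K*₀ X)) E'.id (η-over X) (η-square X)

    η*-commutes : ∀ X → L.arr (K*₀ X) E'.∘ η* X E'.≈ E'.id
    η*-commutes X = FU'.factor-commutes (L.arr-cartesian (K*₀ X)) E'.id (η-over X) (η-square X)

    η*-over : ∀ X → U'.F₁ (η* X) B.≈ η-over X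
    η*-over X = FU'.factor-over (L.arr-cartesian (K*₀ X)) E'.id (η-over X) (η-square X)

    ι : ∀ A → U'.F₀ (R*₀ A) B.⇒ R.F₀ (proj₁ (proj₂ A))
    ι A = B.tr refl (L.dom-over A) B.id

    ε* : ∀ A → PbHom U U' (K*₀ (R*₀ A)) A
    ε* A@(_ , P , a) =
      pbhom (L.arr A) (ε P E.∘ K.F₁ (ι A))
        (transported-counit (L.dom-over A) (K-over _) (K-over _) a
          (L.arr-over A) (K₁-over (ι A)) U.homomorphism)
      where
        transported-counit :
          ∀ {Z V T W X Y} (z : Z ≡ V) (kZ : T ≡ Z) (k : W ≡ V) (a : X ≡ Y)
          {c : Z B.⇒ X} {e : W B.⇒ Y} {kι : T B.⇒ W} {y : T B.⇒ Y} →
          B.tr z refl c B.≈ B.tr k (sym a) e → B.tr kZ k kι B.≈ B.tr refl z B.id →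
          y B.≈ e B.∘ kι → B.tr (sym kZ) a c B.≈ y
        transported-counit refl refl refl refl c≈e kι≈id y≈e∘kι =
          B.Eq.trans c≈e (B.Eq.trans (B.Eq.sym B.identityʳ)
            (B.Eq.trans (B.∘-resp-≈ B.Eq.refl (B.Eq.sym kι≈id)) (B.Eq.sym y≈e∘kι)))

    η*-natural : ∀ {X Y} (u : X E'.⇒ Y) → R*₁ (K*₁ u) E'.∘ η* X E'.≈ η* Y E'.∘ u
    η*-natural {X} {Y} u =
      FU'.cartesian-unique (L.arr-cartesian (K*₀ Y)) (R*₁ (K*₁ u) E'.∘ η* X) (η* Y E'.∘ u)
        (E'.Eq.trans (CategoryProps.extendʳ E' (R*₁-commutes (K*₁ u)))
          (E'.Eq.trans (E'.∘-resp-≈ E'.Eq.refl (η*-commutes X)) E'.identityʳ))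
        (B.Eq.trans U'.homomorphism
          (B.Eq.trans (B.∘-resp-≈ (R*₁-over (K*₁ u)) (η*-over X))
            (transported-naturality (L.dom-over (K*₀ X)) (L.dom-over (K*₀ Y)) (η-natural (U'.F₁ u)))))
        (E'.Eq.trans (E'.Eq.sym E'.assoc)
          (E'.Eq.trans (E'.∘-resp-≈ (η*-commutes Y) E'.Eq.refl) E'.identityˡ))
        (B.Eq.trans U'.homomorphism (B.∘-resp-≈ (η*-over Y) B.Eq.refl))
      where
        transported-naturality :
          ∀ {X Y Z₁ Z₂ V₁ V₂} (z₁ : Z₁ ≡ V₁) (z₂ : Z₂ ≡ V₂)
          {r : V₁ B.⇒ V₂} {η₁ : X B.⇒ V₁} {η₂ : Y B.⇒ V₂} {w : X B.⇒ Y} →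
          r B.∘ η₁ B.≈ η₂ B.∘ w →
          B.tr (sym z₁) (sym z₂) r B.∘ B.tr refl (sym z₁) η₁ B.≈ B.tr refl (sym z₂) η₂ B.∘ w
        transported-naturality refl refl sq = sq

    ε*-natural : ∀ {A₁ A₂} (h : PbHom U U' A₁ A₂) →
                 h U'*E.∘ ε* A₁ U'*E.≈ ε* A₂ U'*E.∘ K*₁ (R*₁ h)
    ε*-natural {A₁@(_ , P₁ , _)} {A₂@(_ , P₂ , _)} h@(pbhom f' f f-eq) =
      E'.Eq.sym (R*₁-commutes h) , counit-square
      where
        open CategoryProps.HomReasoning E

        ι-natural : ∀ {Z₁ Z₂ V₁ V₂} (z₁ : Z₁ ≡ V₁) (z₂ : Z₂ ≡ V₂) {r : V₁ B.⇒ V₂} {m : Z₁ B.⇒ Z₂} →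
                    m B.≈ B.tr (sym z₁) (sym z₂) r →
                    r B.∘ B.tr refl z₁ B.id B.≈ B.tr refl z₂ B.id B.∘ m
        ι-natural refl refl m≈r =
          B.Eq.trans B.identityʳ (B.Eq.trans (B.Eq.sym m≈r) (B.Eq.sym B.identityˡ))

        Rf∘ι : R.F₁ f B.∘ ι A₁ B.≈ ι A₂ B.∘ U'.F₁ (R*₁ h)
        Rf∘ι = ι-natural (L.dom-over A₁) (L.dom-over A₂) (R*₁-over h)

        counit-square : f E.∘ (ε P₁ E.∘ K.F₁ (ι A₁)) E.≈
                        (ε P₂ E.∘ K.F₁ (ι A₂)) E.∘ K.F₁ (U'.F₁ (R*₁ h))
        counit-square = begin
          f E.∘ (ε P₁ E.∘ K.F₁ (ι A₁))                        ≈⟨ E.assoc ⟨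
          (f E.∘ ε P₁) E.∘ K.F₁ (ι A₁)                        ≈⟨ E.∘-resp-≈ (ε-natural f) E.Eq.refl ⟩
          (ε P₂ E.∘ K.F₁ (R.F₁ f)) E.∘ K.F₁ (ι A₁)            ≈⟨ E.assoc ⟩
          ε P₂ E.∘ (K.F₁ (R.F₁ f) E.∘ K.F₁ (ι A₁))            ≈⟨ E.∘-resp-≈ E.Eq.refl K.homomorphism ⟨
          ε P₂ E.∘ K.F₁ (R.F₁ f B.∘ ι A₁)                     ≈⟨ E.∘-resp-≈ E.Eq.refl (K.F-resp-≈ Rf∘ι) ⟩
          ε P₂ E.∘ K.F₁ (ι A₂ B.∘ U'.F₁ (R*₁ h))              ≈⟨ E.∘-resp-≈ E.Eq.refl K.homomorphism ⟩
          ε P₂ E.∘ (K.F₁ (ι A₂) E.∘ K.F₁ (U'.F₁ (R*₁ h)))     ≈⟨ E.assoc ⟨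
          (ε P₂ E.∘ K.F₁ (ι A₂)) E.∘ K.F₁ (U'.F₁ (R*₁ h))     ∎

    zig* : ∀ X → ε* (K*₀ X) U'*E.∘ K*₁ (η* X) U'*E.≈ U'*E.id
    zig* X = η*-commutes X , counit∘Kη≈id
      where
        open CategoryProps.HomReasoning E

        transported-unit : ∀ {Y Z V} (z : Z ≡ V) {m : Y B.⇒ Z} {η : Y B.⇒ V} →
                           m B.≈ B.tr refl (sym z) η → B.tr refl z B.id B.∘ m B.≈ η
        transported-unit refl m≈η = B.Eq.trans B.identityˡ m≈η

        ι∘η* : ι (K*₀ X) B.∘ U'.F₁ (η* X) B.≈ η (U'.F₀ X)
        ι∘η* = transported-unit (L.dom-over (K*₀ X)) (η*-over X)

        counit∘Kη≈id : (ε _ E.∘ K.F₁ (ι (K*₀ X))) E.∘ K.F₁ (U'.F₁ (η* X)) E.≈ E.id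
        counit∘Kη≈id = begin
          (ε _ E.∘ K.F₁ (ι (K*₀ X))) E.∘ K.F₁ (U'.F₁ (η* X))   ≈⟨ E.assoc ⟩
          ε _ E.∘ (K.F₁ (ι (K*₀ X)) E.∘ K.F₁ (U'.F₁ (η* X)))   ≈⟨ E.∘-resp-≈ E.Eq.refl K.homomorphism ⟨
          ε _ E.∘ K.F₁ (ι (K*₀ X) B.∘ U'.F₁ (η* X))            ≈⟨ E.∘-resp-≈ E.Eq.refl (K.F-resp-≈ ι∘η*) ⟩
          ε _ E.∘ K.F₁ (η (U'.F₀ X))                           ≈⟨ zig (U'.F₀ X) ⟩
          E.id                                                  ∎

    zag* : ∀ A → R*₁ (ε* A) E'.∘ η* (R*₀ A) E'.≈ E'.id
    zag* A@(_ , P , _) =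
      FU'.cartesian-unique (L.arr-cartesian A) (R*₁ (ε* A) E'.∘ η* (R*₀ A)) E'.id
        (E'.Eq.trans (CategoryProps.extendʳ E' (R*₁-commutes (ε* A)))
          (E'.Eq.trans (E'.∘-resp-≈ E'.Eq.refl (η*-commutes (R*₀ A))) E'.identityʳ))
        (B.Eq.trans U'.homomorphism
          (B.Eq.trans (B.∘-resp-≈ (R*₁-over (ε* A)) (η*-over (R*₀ A)))
            (transported-zag (L.dom-over A) (L.dom-over (K*₀ (R*₀ A))) Rε*∘η≈ι)))
        E'.identityʳ U'.identity
      where
        open HomReasoning

        transported-zag : ∀ {Z V W S} (z : Z ≡ V) (z' : W ≡ S) {r : S B.⇒ V} {η : Z B.⇒ S} →
                          r B.∘ η B.≈ B.tr refl z B.id →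
                          B.tr (sym z') (sym z) r B.∘ B.tr refl (sym z') η B.≈ B.id
        transported-zag refl refl r∘η≈id = r∘η≈id

        Rε*∘η≈ι : R.F₁ (ε P E.∘ K.F₁ (ι A)) B.∘ η (U'.F₀ (R*₀ A)) B.≈ ι A
        Rε*∘η≈ι = begin
          R.F₁ (ε P E.∘ K.F₁ (ι A)) B.∘ η _              ≈⟨ B.∘-resp-≈ R.homomorphism B.Eq.refl ⟩
          (R.F₁ (ε P) B.∘ R.F₁ (K.F₁ (ι A))) B.∘ η _      ≈⟨ B.assoc ⟩
          R.F₁ (ε P) B.∘ (R.F₁ (K.F₁ (ι A)) B.∘ η _)      ≈⟨ B.∘-resp-≈ B.Eq.refl (η-natural (ι A)) ⟩
          R.F₁ (ε P) B.∘ (η _ B.∘ ι A)                    ≈⟨ B.assoc ⟨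
          (R.F₁ (ε P) B.∘ η _) B.∘ ι A                    ≈⟨ B.∘-resp-≈ (zag P) B.Eq.refl ⟩
          B.id B.∘ ι A                                    ≈⟨ B.identityˡ ⟩
          ι A                                             ∎

    pullback-rightAdjoint : HasRightAdjoint K*
    pullback-rightAdjoint = R* , η* , ε* , η*-natural , ε*-natural , zig* , zag*

lemma4p6 : ∀ {o₁ ℓ₁ e₁ o₂ ℓ₂ e₂ o ℓ e}
             {E : Category o₁ ℓ₁ e₁} {E' : Category o₂ ℓ₂ e₂} {B : Category o ℓ e}
             (U : Functor E B) (U' : Functor E' B) →
             IsCCU U → IsFibration U' → IsCCU (PullbackFunctor U U')
lemma4p6 U U' ccu fib' = record
  { fibration       = pullback-fibration fibration
  ; fibredTerminals = pullback-fibredTerminals fibration fibredTerminals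
  ; K               = Truth.K* K K-truth
  ; K-truth         = Truth.pullback-truth K K-truth
  ; K-rightAdjoint  = RightAdjoint.pullback-rightAdjoint fib' K K-truth K-rightAdjoint
  }
  where
    open IsCCU ccu
    open Pullback U U'
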